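{- Let $\ell, m\ge 2$ and $a,b$ be integers with $1<a<\ell \leq b$, and let $H = H(\ell,m,a,b)$ be the mixed hypergraph defined below. Then $S(H) = [a,\ell-1] \cup \{b\}$. Moreover, every proper $a$-coloring of $H$ is a row-coloring and every proper $b$-coloring of $H$ is a column-coloring.
   Context: A mixed hypergraph is a triple $H=(V,\mathcal{C},\mathcal{D})$ with $V$ a finite vertex set and $\mathcal{C}$, $\mathcal{D}$ sets of subsets of $V$ ($C$-edges and $D$-edges). A coloring $c:V\to\mathbb{N}$ is proper if every $C$-edge contains two vertices of the same color and every $D$-edge contains two vertices of distinct colors; an $s$-coloring uses exactly $s$ colors; $S(H)$ is the set of all $s$ such that $H$ has a proper $s$-coloring. $[i,j]=\{i,\ldots,j\}$. Definition of $H(\ell,m,a,b)$: its vertex set is $V = [a]\times [b] \times [m]$. For $x\in[a]$, the set $\{x\}\times [b]\times[m]$ is a row; for $y\in[b]$, the set $[a]\times\{y\}\times[m]$ is a column. The $C$-edges are all $\ell$-element subsets of $V$ containing at least two vertices from the same column. The $D$-edges are all $m$-element subsets of $V$ that are not contained in any single row and not contained in any single column. A row-coloring is a coloring in which every row is monochromatic and vertices in distinct rows get distinct colors; a column-coloring is a coloring in which every column is monochromatic and vertices in distinct columns get distinct colors. -}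

module Defs where

open import Data.Nat using (ℕ; _≤_; _<_; _∸_)
open import Data.Fin using (Fin)
open import Data.Fin.Base using (toℕ)
open import Data.List using (List; length; filter; allFin; concatMap; map)
open import Data.Bool using (Bool; true; false; T)
open import Data.Bool.Properties using (T?)
open import Data.Product using (_×_; _,_; Σ; ∃; ∃-syntax; proj₁; proj₂)
open import Data.Sum using (_⊎_)
open import Relation.Nullary using (¬_)
open import Relation.Binary.PropositionalEquality using (_≡_; _≢_)
open import Function.Definitions using (Surjective)

V : ℕ → ℕ → ℕ → Set
V a b m = Fin a × Fin b × Fin m

row : ∀ {a b m} → V a b m → Fin a
row (x , _ , _) = x

col : ∀ {a b m} → V a b m → Fin b
col (_ , y , _) = y

allV : ∀ a b m → List (V a b m)
allV a b m = concatMap (λ x → concatMap (λ y → map (λ z → x , y , z) (allFin m)) (allFin b)) (allFin a)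

SubsetV : ℕ → ℕ → ℕ → Set
SubsetV a b m = V a b m → Bool

_∈E_ : ∀ {a b m} → V a b m → SubsetV a b m → Set
v ∈E E = T (E v)

card : ∀ {a b m} → SubsetV a b m → ℕ
card {a} {b} {m} E = length (filter (λ v → T? (E v)) (allV a b m))

IsCEdge : ∀ ℓ {a b m} → SubsetV a b m → Set
IsCEdge ℓ {a} {b} {m} E =
  card E ≡ ℓ × ∃[ u ] ∃[ v ] (u ≢ v × u ∈E E × v ∈E E × col u ≡ col v)

IsDEdge : ∀ {a b m} → SubsetV a b m → Set
IsDEdge {a} {b} {m} E =
  card E ≡ m
  × ¬ (∃[ x ] (∀ v → v ∈E E → row v ≡ x))
  × ¬ (∃[ y ] (∀ v → v ∈E E → col v ≡ y))

Proper : ∀ ℓ a b m {C : Set} → (V a b m → C) → Set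
Proper ℓ a b m c =
  (∀ E → IsCEdge ℓ E → ∃[ u ] ∃[ v ] (u ≢ v × u ∈E E × v ∈E E × c u ≡ c v))
  × (∀ (E : SubsetV a b m) → IsDEdge E → ∃[ u ] ∃[ v ] (u ∈E E × v ∈E E × c u ≢ c v))

-- An s-coloring: a coloring using exactly s colors, i.e. a map onto Fin s.
IsSColoring : ∀ {a b m} s → (V a b m → Fin s) → Set
IsSColoring s c = Surjective _≡_ _≡_ c

InSpectrum : ℕ → ℕ → ℕ → ℕ → ℕ → Set
InSpectrum ℓ m a b s = Σ (V a b m → Fin s) λ c → IsSColoring s c × Proper ℓ a b m c

RowColoring : ∀ {a b m} {C : Set} → (V a b m → C) → Set
RowColoring c = ∀ u v → (row u ≡ row v → c u ≡ c v) × (row u ≢ row v → c u ≢ c v)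

ColColoring : ∀ {a b m} {C : Set} → (V a b m → C) → Set
ColColoring c = ∀ u v → (col u ≡ col v → c u ≡ c v) × (col u ≢ col v → c u ≢ c v)

-- Edges are handled through duplicate-free lists of vertices: any such list of
-- length ≥ k through two prescribed vertices contains a k-element one
-- (extend-pair), whose cardinality as a subset is its length (card-⟦⟧).  For a
-- proper colouring this yields (module Edges): no monochromatic m-set meets two
-- rows and two columns, and no rainbow ℓ-set has two vertices in one column.
--   * ManyColours (s ≥ ℓ colours): two vertices of distinct colours lie in the
--     rainbow image of a section of the colouring, so columns are monochromatic;
--     a cell plus one further vertex shows that distinct columns get distinct
--     colours.  Hence the colouring is a column colouring and s = b.
--   * FewColours (s < b colours): a row has b·m > s·m vertices, so more than m
--     of them share a colour (generalised pigeonhole), and that colour occurs in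
--     no other row.  Rows thus inject into colours, so a ≤ s; for s = a every
--     colour belongs to a row and the colouring is a row colouring.
--   * SplitColouring (a ≤ s < ℓ): the row colouring with row 0 split into
--     s - a + 1 colours is proper; the column colouring realises b.

module Submission where

open import Defs
open import Data.Nat
  using (ℕ; zero; suc; _≤_; _<_; _∸_; _+_; _*_; z≤n; s≤s; _⊓_; _<?_; _≤?_; NonZero; >-nonZero)
  renaming (_≟_ to _≟ℕ_)
import Data.Nat.Properties as ℕ
open import Data.Fin using (Fin; zero; suc; toℕ; fromℕ<)
import Data.Fin.Properties as Fin
open import Data.List using (List; []; _∷_; length; filter; take; lookup; concatMap; map; allFin)
open import Data.List.Properties using (filter-notAll; length-take; length-++; length-map; length-tabulate)
open import Data.List.Relation.Unary.All as All using (All; []; _∷_; all?)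
import Data.List.Relation.Unary.All.Properties as AllP
open import Data.List.Relation.Unary.Any as Any using (here; there)
open import Data.List.Relation.Unary.AllPairs using ([]; _∷_)
open import Data.List.Relation.Unary.Unique.Propositional using (Unique)
import Data.List.Relation.Unary.Unique.Propositional.Properties as UniqueP
open import Data.List.Membership.Propositional using (_∈_; find)
open import Data.List.Membership.Propositional.Properties
  using ( ∈-filter⁺; ∈-filter⁻; ∈-lookup; ∈-concatMap⁺; ∈-concatMap⁻
        ; ∈-map⁺; ∈-map⁻; ∈-allFin)
import Data.List.Membership.DecPropositional as DecMembership
open import Data.List.Relation.Binary.Subset.Propositional using (_⊆_)
import Data.List.Relation.Binary.Sublist.Propositional as Sublist
import Data.List.Relation.Binary.Sublist.Propositional.Properties as SublistP
open import Data.List.Relation.Binary.Disjoint.Propositional using (Disjoint)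
open import Data.Vec.Functional using (updateAt)
import Data.Vec.Functional as Vector
open import Data.Vec.Functional.Properties using (updateAt-updates; updateAt-minimal)
open import Data.Bool.Properties using (T?)
open import Data.Product using (_×_; _,_; Σ; ∃₂; ∃-syntax; proj₁; proj₂)
open import Data.Product.Properties using (≡-dec)
open import Data.Sum using (_⊎_; inj₁; inj₂)
open import Data.Empty using (⊥; ⊥-elim)
open import Function using (_∘_; id; const)
open import Function.Bundles using (_⇔_; mk⇔)
open import Function.Definitions using (Injective)
open import Relation.Nullary using (¬_; Dec; yes; no)
open import Relation.Nullary.Decidable using (¬?; _×-dec_; isYes; toWitness; fromWitness)
open import Relation.Binary.PropositionalEquality
  using (_≡_; _≢_; refl; sym; trans; cong; cong₂; subst; subst₂; module ≡-Reasoning)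
open import Relation.Binary.Definitions using (DecidableEquality)

module _ {A : Set} where

  lookup-injective : ∀ {xs : List A} → Unique xs → ∀ {i j} → lookup xs i ≡ lookup xs j → i ≡ j
  lookup-injective (_ ∷ _) {zero} {zero} _ = refl
  lookup-injective (x∉xs ∷ _) {zero} {suc j} eq = ⊥-elim (All.lookup x∉xs (∈-lookup j) eq)
  lookup-injective (x∉xs ∷ _) {suc i} {zero} eq = ⊥-elim (All.lookup x∉xs (∈-lookup i) (sym eq))
  lookup-injective (_ ∷ uxs) {suc i} {suc j} eq = cong suc (lookup-injective uxs eq)

  pigeonhole : ∀ {n} (f : A → Fin n) {xs : List A} → Unique xs → n < length xs →
    ∃₂ λ u v → u ∈ xs × v ∈ xs × u ≢ v × f u ≡ f v
  pigeonhole f {xs} uxs n<len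
    with i , j , i<j , fi≡fj ← Fin.pigeonhole n<len (f ∘ lookup xs)
    = lookup xs i , lookup xs j , ∈-lookup i , ∈-lookup j
    , (λ eq → Fin.<⇒≢ i<j (lookup-injective uxs eq)) , fi≡fj

  non-constant : ∀ {B : Set} → DecidableEquality B → (g : A → B) (xs : List A) → 0 < length xs →
    ¬ (∃[ y ] ∀ {w} → w ∈ xs → g w ≡ y) → ∃₂ λ u v → u ∈ xs × v ∈ xs × g u ≢ g v
  non-constant _≟_ g (w₀ ∷ xs) _ not-constant with all? (λ w → g w ≟ g w₀) (w₀ ∷ xs)
  ... | yes all-equal = ⊥-elim (not-constant (g w₀ , All.lookup all-equal))
  ... | no ¬all-equal
    with w , w∈ , gw≢gw₀ ← find (AllP.¬All⇒Any¬ (λ w → g w ≟ g w₀) (w₀ ∷ xs) ¬all-equal)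
    = w , w₀ , w∈ , here refl , gw≢gw₀

  unique-concatMap : ∀ {B : Set} (f : A → List B) {xs : List A} → Unique xs →
    (∀ x → Unique (f x)) → (∀ {x x' w} → w ∈ f x → w ∈ f x' → x ≡ x') →
    Unique (concatMap f xs)
  unique-concatMap f {[]} _ _ _ = []
  unique-concatMap f {x ∷ xs} (x∉xs ∷ uxs) uf block =
    UniqueP.++⁺ (uf x) (unique-concatMap f uxs uf block) disjoint
    where
    disjoint : Disjoint (f x) (concatMap f xs)
    disjoint (w∈fx , w∈rest) with x' , x'∈ , w∈fx' ← find (∈-concatMap⁻ f {xs = xs} w∈rest)
      = All.lookup x∉xs x'∈ (block w∈fx w∈fx')

  length-concatMap : ∀ {B : Set} (f : A → List B) k (xs : List A) → (∀ x → length (f x) ≡ k) →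
    length (concatMap f xs) ≡ length xs * k
  length-concatMap f k [] _ = refl
  length-concatMap f k (x ∷ xs) len =
    trans (length-++ (f x)) (cong₂ _+_ (len x) (length-concatMap f k xs len))

module _ {A : Set} (_≟_ : DecidableEquality A) where

  unique-⊆⇒length≤ : ∀ {xs ys : List A} → Unique xs → xs ⊆ ys → length xs ≤ length ys
  unique-⊆⇒length≤ {[]} _ _ = z≤n
  unique-⊆⇒length≤ {x ∷ xs} {ys} (x∉xs ∷ uxs) x∷xs⊆ys = begin
    suc (length xs)         ≤⟨ s≤s (unique-⊆⇒length≤ uxs xs⊆ys-x) ⟩
    suc (length (ys - x))   ≤⟨ filter-notAll (λ y → ¬? (x ≟ y)) ys x∈ys ⟩
    length ys               ∎
    where
    open ℕ.≤-Reasoning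
    _-_ : List A → A → List A
    zs - z = filter (λ y → ¬? (z ≟ y)) zs
    x∈ys : Any.Any (λ y → ¬ (x ≢ y)) ys
    x∈ys = Any.map (λ x≡y x≢y → x≢y x≡y) (x∷xs⊆ys (here refl))
    xs⊆ys-x : xs ⊆ ys - x
    xs⊆ys-x {w} w∈xs =
      ∈-filter⁺ (λ y → ¬? (x ≟ y)) (x∷xs⊆ys (there w∈xs)) (All.lookup x∉xs w∈xs)

  extend-pair : ∀ {k} {xs : List A} {p q} → Unique xs → p ∈ xs → q ∈ xs → p ≢ q →
    2 ≤ k → k ≤ length xs →
    Σ (List A) λ ys → Unique ys × length ys ≡ k × p ∈ ys × q ∈ ys × ys ⊆ xs
  extend-pair {k} {xs} {p} {q} uxs p∈xs q∈xs p≢q 2≤k k≤|xs| =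
    ys , unique-ys , length-ys , here refl , there (here refl) , ys⊆xs
    where
    other? : ∀ w → Dec (p ≢ w × q ≢ w)
    other? w = ¬? (p ≟ w) ×-dec ¬? (q ≟ w)
    others rest ys : List A
    others = filter other? xs
    rest = take (k ∸ 2) others
    ys = p ∷ q ∷ rest
    rest⊆others : rest Sublist.⊆ others
    rest⊆others = SublistP.take-⊆ (k ∸ 2) others
    rest-other : All (λ w → p ≢ w × q ≢ w) rest
    rest-other = AllP.take⁺ (k ∸ 2) (AllP.all-filter other? xs)
    unique-ys : Unique ys
    unique-ys = (p≢q ∷ All.map proj₁ rest-other) ∷ All.map proj₂ rest-other
              ∷ UniqueP.take⁺ (k ∸ 2) (UniqueP.filter⁺ other? uxs)
    xs⊆p∷q∷others : xs ⊆ p ∷ q ∷ others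
    xs⊆p∷q∷others {w} w∈xs with p ≟ w | q ≟ w
    ... | yes p≡w | _ = here (sym p≡w)
    ... | no _ | yes q≡w = there (here (sym q≡w))
    ... | no p≢w | no q≢w = there (there (∈-filter⁺ other? w∈xs (p≢w , q≢w)))
    enough-others : k ∸ 2 ≤ length others
    enough-others = ℕ.≤-trans
      (ℕ.∸-monoˡ-≤ 2 (ℕ.≤-trans k≤|xs| (unique-⊆⇒length≤ uxs xs⊆p∷q∷others)))
      (ℕ.≤-reflexive (ℕ.m+n∸m≡n 2 (length others)))
    length-ys : length ys ≡ k
    length-ys = begin
      2 + length (take (k ∸ 2) others) ≡⟨ cong (2 +_) (length-take (k ∸ 2) others) ⟩
      2 + (k ∸ 2) ⊓ length others    ≡⟨ cong (2 +_) (ℕ.m≤n⇒m⊓n≡m enough-others) ⟩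
      2 + (k ∸ 2)                      ≡⟨ ℕ.m+[n∸m]≡n 2≤k ⟩
      k                                ∎
      where open ≡-Reasoning
    ys⊆xs : ys ⊆ xs
    ys⊆xs (here refl) = p∈xs
    ys⊆xs (there (here refl)) = q∈xs
    ys⊆xs (there (there w∈rest)) =
      proj₁ (∈-filter⁻ other? {xs = xs} (Sublist.lookup rest⊆others w∈rest))

module _ {A : Set} where

  length-filter-split : ∀ {P : A → Set} (P? : ∀ w → Dec (P w)) (xs : List A) →
    length xs ≡ length (filter P? xs) + length (filter (¬? ∘ P?) xs)
  length-filter-split P? [] = refl
  length-filter-split P? (x ∷ xs) with P? x
  ... | yes _ = cong suc (length-filter-split P? xs)
  ... | no _ = trans (cong suc (length-filter-split P? xs)) (sym (ℕ.+-suc _ _))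

  crowded-label : ∀ m s (g : A → ℕ) (xs : List A) → All (λ w → g w < s) xs → s * m < length xs →
    ∃[ k ] m < length (filter (λ w → g w ≟ℕ k) xs)
  crowded-label m zero g [] _ ()
  crowded-label m zero g (x ∷ _) (() ∷ _) _
  crowded-label m (suc s) g xs bounded large with m ℕ.<? length (filter (λ w → g w ≟ℕ s) xs)
  ... | yes crowded = s , crowded
  ... | no ¬crowded = k , ℕ.<-≤-trans crowded (SublistP.length-mono-≤ restriction)
    where
    labelled? : ∀ k w → Dec (g w ≡ k)
    labelled? k w = g w ≟ℕ k
    rest : List A
    rest = filter (¬? ∘ labelled? s) xs
    rest-bounded : All (λ w → g w < s) rest
    rest-bounded = All.map (λ (gw<1+s , gw≢s) → ℕ.≤∧≢⇒< (ℕ.≤-pred gw<1+s) gw≢s)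
      (All.zip (AllP.filter⁺ (¬? ∘ labelled? s) bounded , AllP.all-filter (¬? ∘ labelled? s) xs))
    rest-large : s * m < length rest
    rest-large = ℕ.+-cancelˡ-< m _ _ (ℕ.<-≤-trans large (begin
      length xs                                      ≡⟨ length-filter-split (labelled? s) xs ⟩
      length (filter (labelled? s) xs) + length rest ≤⟨ ℕ.+-monoˡ-≤ _ (ℕ.≮⇒≥ ¬crowded) ⟩
      m + length rest                                ∎))
      where open ℕ.≤-Reasoning
    smaller-crowd : ∃[ k ] m < length (filter (labelled? k) rest)
    smaller-crowd = crowded-label m s g rest rest-bounded rest-large
    k : ℕ
    k = proj₁ smaller-crowd
    crowded : m < length (filter (labelled? k) rest)
    crowded = proj₂ smaller-crowd
    restriction : filter (labelled? k) rest Sublist.⊆ filter (labelled? k) xs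
    restriction = SublistP.filter⁺ (labelled? k) (labelled? k) (λ { refl → id })
                    (SublistP.filter-⊆ (¬? ∘ labelled? s) xs)

two-elements : ∀ {n} → 1 < n → Σ (Fin n) λ i → Σ (Fin n) λ j → i ≢ j
two-elements (s≤s (s≤s _)) = zero , suc zero , λ ()

-- An injective map from Fin n to itself is onto (pigeonhole on Fin (1 + n)).
injective⇒onto : ∀ {n} (f : Fin n → Fin n) → Injective _≡_ _≡_ f → ∀ k → ∃[ x ] f x ≡ k
injective⇒onto {n} f f-injective k
  with Fin.pigeonhole (ℕ.n<1+n n) (k Vector.∷ f)
... | zero , zero , () , _
... | suc _ , zero , () , _
... | zero , suc x , _ , k≡fx = x , sym k≡fx
... | suc x , suc x' , x<x' , fx≡fx' = ⊥-elim (Fin.<⇒≢ x<x' (cong suc (f-injective fx≡fx')))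

length-allFin : ∀ n → length (allFin n) ≡ n
length-allFin n = length-tabulate id

module Vertices (a b m : ℕ) where

  _≟V_ : DecidableEquality (V a b m)
  _≟V_ = ≡-dec Fin._≟_ (≡-dec Fin._≟_ Fin._≟_)

  cell : Fin a → Fin b → List (V a b m)
  cell x y = map (λ z → x , y , z) (allFin m)

  rowList : Fin a → List (V a b m)
  rowList x = concatMap (cell x) (allFin b)

  cell-position : ∀ {x y w} → w ∈ cell x y → row w ≡ x × col w ≡ y
  cell-position w∈ with _ , _ , refl ← ∈-map⁻ _ w∈ = refl , refl

  ∈-cell : ∀ w → w ∈ cell (row w) (col w)
  ∈-cell (x , y , z) = ∈-map⁺ _ (∈-allFin z)

  rowList-position : ∀ {x w} → w ∈ rowList x → row w ≡ x
  rowList-position w∈ with _ , _ , w∈cell ← find (∈-concatMap⁻ (cell _) {xs = allFin b} w∈)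
    = proj₁ (cell-position w∈cell)

  ∈-rowList : ∀ w → w ∈ rowList (row w)
  ∈-rowList w = ∈-concatMap⁺ (cell (row w)) (Any.map (λ { refl → ∈-cell w }) (∈-allFin (col w)))

  ∈-allV : ∀ w → w ∈ allV a b m
  ∈-allV w = ∈-concatMap⁺ rowList (Any.map (λ { refl → ∈-rowList w }) (∈-allFin (row w)))

  unique-cell : ∀ x y → Unique (cell x y)
  unique-cell x y = UniqueP.map⁺ (λ { refl → refl }) (UniqueP.allFin⁺ m)

  unique-rowList : ∀ x → Unique (rowList x)
  unique-rowList x = unique-concatMap (cell x) (UniqueP.allFin⁺ b) (unique-cell x)
    (λ w∈ w∈' → trans (sym (proj₂ (cell-position w∈))) (proj₂ (cell-position w∈')))

  unique-allV : Unique (allV a b m)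
  unique-allV = unique-concatMap rowList (UniqueP.allFin⁺ a) unique-rowList
    (λ w∈ w∈' → trans (sym (rowList-position w∈)) (rowList-position w∈'))

  length-cell : ∀ x y → length (cell x y) ≡ m
  length-cell x y = trans (length-map _ (allFin m)) (length-allFin m)

  length-rowList : ∀ x → length (rowList x) ≡ b * m
  length-rowList x = trans (length-concatMap (cell x) m (allFin b) (length-cell x))
                           (cong (_* m) (length-allFin b))

  members : SubsetV a b m → List (V a b m)
  members E = filter (λ v → T? (E v)) (allV a b m)

  unique-members : ∀ E → Unique (members E)
  unique-members E = UniqueP.filter⁺ (λ v → T? (E v)) unique-allV

  open DecMembership _≟V_ using (_∈?_)

  ⟦_⟧ : List (V a b m) → SubsetV a b m
  ⟦ ys ⟧ w = isYes (w ∈? ys)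

  members⁺ : ∀ {E w} → w ∈E E → w ∈ members E
  members⁺ {E} {w} w∈E = ∈-filter⁺ (λ v → T? (E v)) (∈-allV w) w∈E

  members⁻ : ∀ {E w} → w ∈ members E → w ∈E E
  members⁻ {E} w∈ = proj₂ (∈-filter⁻ (λ v → T? (E v)) {xs = allV a b m} w∈)

  ⟦⟧⁺ : ∀ {ys w} → w ∈ ys → w ∈E ⟦ ys ⟧
  ⟦⟧⁺ = fromWitness

  ⟦⟧⁻ : ∀ {ys w} → w ∈E ⟦ ys ⟧ → w ∈ ys
  ⟦⟧⁻ = toWitness

  card-⟦⟧ : ∀ {ys} → Unique ys → card ⟦ ys ⟧ ≡ length ys
  card-⟦⟧ {ys} uys = ℕ.≤-antisym
    (unique-⊆⇒length≤ _≟V_ (unique-members ⟦ ys ⟧)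
      (λ w∈ → ⟦⟧⁻ (members⁻ {⟦ ys ⟧} w∈)))
    (unique-⊆⇒length≤ _≟V_ uys (λ w∈ → members⁺ {⟦ ys ⟧} (⟦⟧⁺ w∈)))

module Edges (ℓ a b m : ℕ) where
  open Vertices a b m

  Rainbow : ∀ {C : Set} → (V a b m → C) → List (V a b m) → Set
  Rainbow c xs = ∀ {w w'} → w ∈ xs → w' ∈ xs → c w ≡ c w' → w ≡ w'

  module _ {C : Set} (c : V a b m → C) (proper : Proper ℓ a b m c) where

    -- Every ℓ-set with two vertices in one column is a C-edge, hence not rainbow;
    -- so a rainbow set of at least ℓ vertices has no two vertices in one column.
    no-rainbow-column-pair : 2 ≤ ℓ → ∀ {xs u v} → Unique xs → ℓ ≤ length xs → Rainbow c xs →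
      u ∈ xs → v ∈ xs → u ≢ v → col u ≡ col v → ⊥
    no-rainbow-column-pair 2≤ℓ {xs} {u} {v} uxs ℓ≤|xs| rainbow u∈ v∈ u≢v same-column
      with ys , uys , |ys|≡ℓ , u∈ys , v∈ys , ys⊆xs ←
             extend-pair _≟V_ uxs u∈ v∈ u≢v 2≤ℓ ℓ≤|xs|
      with u' , v' , u'≢v' , u'∈ , v'∈ , same-colour ← proj₁ proper ⟦ ys ⟧
             (trans (card-⟦⟧ uys) |ys|≡ℓ , u , v , u≢v , ⟦⟧⁺ u∈ys , ⟦⟧⁺ v∈ys , same-column)
      = u'≢v' (rainbow (ys⊆xs (⟦⟧⁻ u'∈)) (ys⊆xs (⟦⟧⁻ v'∈)) same-colour)

    -- Every m-set containing two vertices that differ in row and in column is a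
    -- D-edge, hence not monochromatic.
    no-monochromatic-crossing-pair : 2 ≤ m → ∀ {xs p q} {κ : C} → Unique xs → m ≤ length xs →
      (∀ {w} → w ∈ xs → c w ≡ κ) → p ∈ xs → q ∈ xs → row p ≢ row q → col p ≢ col q → ⊥
    no-monochromatic-crossing-pair 2≤m {xs} {p} {q} uxs m≤|xs| monochromatic p∈ q∈ rows columns
      with ys , uys , |ys|≡m , p∈ys , q∈ys , ys⊆xs ←
             extend-pair _≟V_ uxs p∈ q∈ (λ p≡q → rows (cong row p≡q)) 2≤m m≤|xs|
      with u , v , u∈ , v∈ , different-colours ← proj₂ proper ⟦ ys ⟧
             ( trans (card-⟦⟧ uys) |ys|≡m
             , (λ (x , in-x) → rows (trans (in-x p (⟦⟧⁺ p∈ys)) (sym (in-x q (⟦⟧⁺ q∈ys)))))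
             , (λ (y , in-y) → columns (trans (in-y p (⟦⟧⁺ p∈ys)) (sym (in-y q (⟦⟧⁺ q∈ys))))))
      = different-colours (trans (monochromatic (ys⊆xs (⟦⟧⁻ u∈)))
                                 (sym (monochromatic (ys⊆xs (⟦⟧⁻ v∈)))))

  spread : ∀ {n} (g : V a b m → Fin n) (E : SubsetV a b m) → 0 < card E →
    ¬ (∃[ x ] ∀ v → v ∈E E → g v ≡ x) → ∃₂ λ u v → u ∈E E × v ∈E E × g u ≢ g v
  spread g E nonempty not-level
    with u , v , u∈ , v∈ , gu≢gv ← non-constant Fin._≟_ g (members E) nonempty
             (λ (x , level) → not-level (x , λ v v∈E → level (members⁺ {E} v∈E)))
    = u , v , members⁻ {E} u∈ , members⁻ {E} v∈ , gu≢gv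

  -- A colouring with fewer than ℓ colours giving distinct rows distinct colours is proper:
  -- C-edges have ℓ vertices (pigeonhole) and D-edges meet two rows.
  row-separating⇒proper : 0 < m → ∀ {s} (c : V a b m → Fin s) → s < ℓ →
    (∀ u v → row u ≢ row v → c u ≢ c v) → Proper ℓ a b m c
  row-separating⇒proper 0<m {s} c s<ℓ separates = C-edges , D-edges
    where
    C-edges : ∀ E → IsCEdge ℓ E → ∃[ u ] ∃[ v ] (u ≢ v × u ∈E E × v ∈E E × c u ≡ c v)
    C-edges E (|E|≡ℓ , _)
      with u , v , u∈ , v∈ , u≢v , same-colour ←
             pigeonhole c (unique-members E) (subst (s <_) (sym |E|≡ℓ) s<ℓ)
      = u , v , u≢v , members⁻ {E} u∈ , members⁻ {E} v∈ , same-colour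
    D-edges : ∀ E → IsDEdge E → ∃[ u ] ∃[ v ] (u ∈E E × v ∈E E × c u ≢ c v)
    D-edges E (|E|≡m , not-one-row , _)
      with u , v , u∈ , v∈ , rows ← spread row E (subst (0 <_) (sym |E|≡m) 0<m) not-one-row
      = u , v , u∈ , v∈ , separates u v rows

  column-colouring-proper : 0 < m → Proper ℓ a b m (col {a} {b} {m})
  column-colouring-proper 0<m =
      (λ E (_ , u , v , u≢v , u∈ , v∈ , same-column) → u , v , u≢v , u∈ , v∈ , same-column)
    , (λ E (|E|≡m , _ , not-one-column) → spread col E (subst (0 <_) (sym |E|≡m) 0<m) not-one-column)

module ManyColours (ℓ a b m : ℕ) (2≤ℓ : 2 ≤ ℓ) (2≤m : 2 ≤ m) (1<a : 1 < a)
                   {s} (c : V a b m → Fin s) (onto : IsSColoring s c) (proper : Proper ℓ a b m c)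
                   (ℓ≤s : ℓ ≤ s) where
  open Vertices a b m
  open Edges ℓ a b m

  Section : (Fin s → V a b m) → Set
  Section σ = ∀ k → c (σ k) ≡ k

  representative : Fin s → V a b m
  representative k = proj₁ (onto k)

  representative-section : Section representative
  representative-section k = proj₂ (onto k) refl

  redirect : ∀ {σ} → Section σ → ∀ u → Section (updateAt σ (c u) (const u))
  redirect {σ} section u k with k Fin.≟ c u
  ... | yes refl = cong c (updateAt-updates (c u) σ)
  ... | no k≢cu = trans (cong c (updateAt-minimal k (c u) σ k≢cu)) (section k)

  module Image {σ} (section : Section σ) where
    image : List (V a b m)
    image = map σ (allFin s)

    σ-injective : ∀ {k k'} → σ k ≡ σ k' → k ≡ k'
    σ-injective {k} {k'} eq = trans (sym (section k)) (trans (cong c eq) (section k'))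

    unique-image : Unique image
    unique-image = UniqueP.map⁺ σ-injective (UniqueP.allFin⁺ s)

    length-image : length image ≡ s
    length-image = trans (length-map σ (allFin s)) (length-allFin s)

    rainbow-image : Rainbow c image
    rainbow-image w∈ w'∈ same-colour
      with k , _ , refl ← ∈-map⁻ σ w∈ | k' , _ , refl ← ∈-map⁻ σ w'∈
      = cong σ (trans (sym (section k)) (trans same-colour (section k')))

    ∈-image : ∀ k → σ k ∈ image
    ∈-image k = ∈-map⁺ σ (∈-allFin k)

  rainbow-through : ∀ {u v} → c u ≢ c v →
    Σ (List (V a b m)) λ xs → Unique xs × length xs ≡ s × Rainbow c xs × u ∈ xs × v ∈ xs
  rainbow-through {u} {v} cu≢cv =
    image , unique-image , length-image , rainbow-image
    , subst (_∈ image) σ-at-u (∈-image (c u)) , subst (_∈ image) σ-at-v (∈-image (c v))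
    where
    σ-v σ : Fin s → V a b m
    σ-v = updateAt representative (c v) (const v)
    σ = updateAt σ-v (c u) (const u)
    open Image (redirect (redirect representative-section v) u)
    σ-at-u : σ (c u) ≡ u
    σ-at-u = updateAt-updates (c u) σ-v
    σ-at-v : σ (c v) ≡ v
    σ-at-v = trans (updateAt-minimal (c v) (c u) σ-v (λ eq → cu≢cv (sym eq)))
                   (updateAt-updates (c v) representative)

  -- Columns are monochromatic: otherwise a rainbow list of s ≥ ℓ vertices
  -- would contain two vertices of one column.
  same-column⇒same-colour : ∀ u v → col u ≡ col v → c u ≡ c v
  same-column⇒same-colour u v same-column with c u Fin.≟ c v
  ... | yes same-colour = same-colour
  ... | no cu≢cv with xs , uxs , |xs|≡s , rainbow , u∈ , v∈ ← rainbow-through cu≢cv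
    = ⊥-elim (no-rainbow-column-pair c proper 2≤ℓ uxs
               (ℕ.≤-trans ℓ≤s (ℕ.≤-reflexive (sym |xs|≡s))) rainbow u∈ v∈ (λ u≡v → cu≢cv (cong c u≡v)) same-column)

  r₀ r₁ : Fin a
  r₀ = proj₁ (two-elements 1<a)
  r₁ = proj₁ (proj₂ (two-elements 1<a))

  z₀ : Fin m
  z₀ = fromℕ< (ℕ.<-≤-trans (s≤s z≤n) 2≤m)

  -- Distinct columns have distinct colours: otherwise the cell (r₀, col u) together with
  -- (r₁, col v, z₀) would be a monochromatic (m+1)-set crossing rows and columns.
  same-colour⇒same-column : ∀ u v → c u ≡ c v → col u ≡ col v
  same-colour⇒same-column u v same-colour with col u Fin.≟ col v
  ... | yes same-column = same-column
  ... | no columns = ⊥-elim (no-monochromatic-crossing-pair c proper 2≤m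
          unique-xs m≤|xs| monochromatic (here refl) (there (∈-cell p)) rows (λ eq → columns (sym eq)))
    where
    q p : V a b m
    xs : List (V a b m)
    xs = q ∷ cell r₀ (col u)
    q = r₁ , col v , z₀
    p = r₀ , col u , z₀
    rows : r₁ ≢ r₀
    rows eq = proj₂ (proj₂ (two-elements 1<a)) (sym eq)
    unique-xs : Unique xs
    unique-xs = q∉cell ∷ unique-cell r₀ (col u)
      where
      q∉cell : All (q ≢_) (cell r₀ (col u))
      q∉cell = All.tabulate (λ w∈ q≡w → columns (sym (trans (cong col q≡w) (proj₂ (cell-position w∈)))))
    m≤|xs| : m ≤ length xs
    m≤|xs| = ℕ.≤-trans (ℕ.n≤1+n m) (s≤s (ℕ.≤-reflexive (sym (length-cell r₀ (col u)))))
    monochromatic : ∀ {w} → w ∈ xs → c w ≡ c u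
    monochromatic (here refl) = trans (same-column⇒same-colour q v refl) (sym same-colour)
    monochromatic (there w∈) = same-column⇒same-colour _ u (proj₂ (cell-position w∈))

  column-colouring : ColColoring c
  column-colouring u v = same-column⇒same-colour u v
                       , λ columns same-colour → columns (same-colour⇒same-column u v same-colour)

  colours≡columns : s ≡ b
  colours≡columns = sym (Fin.cantor-schröder-bernstein {f = colour-of-column} {g = column-of-colour}
    (same-colour⇒same-column _ _)
    (λ {k} {k'} eq → trans (sym (representative-section k))
                     (trans (same-column⇒same-colour _ _ eq) (representative-section k'))))
    where
    colour-of-column : Fin b → Fin s
    colour-of-column y = c (r₀ , y , z₀)
    column-of-colour : Fin s → Fin b
    column-of-colour k = col (representative k)

module FewColours (ℓ a b m : ℕ) (2≤m : 2 ≤ m) {s} (c : V a b m → Fin s)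
                  (proper : Proper ℓ a b m c) (s<b : s < b) where
  open Vertices a b m
  open Edges ℓ a b m

  Private : Fin a → Fin s → Set
  Private x κ = (∃[ w ] row w ≡ x × c w ≡ κ) × (∀ w → c w ≡ κ → row w ≡ x)

  -- More than m vertices of row x in colour κ do not fit into one cell, so one of
  -- them, p, avoids the column of any vertex r of colour κ outside row x; then
  -- r, p and the rest would form a monochromatic m-set crossing rows and columns.
  crowded⇒confined : ∀ {x κ L} → Unique L → m < length L → (∀ {w} → w ∈ L → row w ≡ x) →
    (∀ {w} → w ∈ L → c w ≡ κ) → ∀ r → c r ≡ κ → row r ≡ x
  crowded⇒confined {x} {κ} {L} uL m<|L| in-row monochromatic r cr≡κ with row r Fin.≟ x
  ... | yes in-x = in-x
  ... | no outside with all? (λ w → col w Fin.≟ col r) L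
  ...   | yes one-column = ⊥-elim (ℕ.<⇒≱ m<|L| (begin
            length L                ≤⟨ unique-⊆⇒length≤ _≟V_ uL L⊆cell ⟩
            length (cell x (col r)) ≡⟨ length-cell x (col r) ⟩
            m                       ∎))
    where
    open ℕ.≤-Reasoning
    L⊆cell : L ⊆ cell x (col r)
    L⊆cell w∈ =
      subst₂ (λ x' y' → _ ∈ cell x' y') (in-row w∈) (All.lookup one-column w∈) (∈-cell _)
  ...   | no ¬one-column
    with p , p∈ , col-p≢col-r ← find (AllP.¬All⇒Any¬ (λ w → col w Fin.≟ col r) L ¬one-column)
    = ⊥-elim (no-monochromatic-crossing-pair c proper 2≤m unique-r∷L (ℕ.m≤n⇒m≤1+n (ℕ.<⇒≤ m<|L|))
                monochromatic-r∷L (here refl) (there p∈)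
                (λ eq → outside (trans eq (in-row p∈))) (λ eq → col-p≢col-r (sym eq)))
    where
    unique-r∷L : Unique (r ∷ L)
    unique-r∷L = All.tabulate (λ w∈ r≡w → outside (trans (cong row r≡w) (in-row w∈))) ∷ uL
    monochromatic-r∷L : ∀ {w} → w ∈ r ∷ L → c w ≡ κ
    monochromatic-r∷L (here refl) = cr≡κ
    monochromatic-r∷L (there w∈) = monochromatic w∈

  crowded⇒private : ∀ {x L} → Unique L → m < length L → (∀ {w} → w ∈ L → row w ≡ x) →
    (∀ {w w'} → w ∈ L → w' ∈ L → c w ≡ c w') → ∃[ κ ] Private x κ
  crowded⇒private {L = []} _ () _ _
  crowded⇒private {L = w₀ ∷ L} uL m<|L| in-row same-colour =
    c w₀ , (w₀ , in-row (here refl) , refl)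
    , crowded⇒confined uL m<|L| in-row (λ w∈ → same-colour w∈ (here refl))

  -- needed by the monotonicity of multiplication by m
  instance
    m-nonzero : NonZero m
    m-nonzero = >-nonZero (ℕ.<-≤-trans (s≤s z≤n) 2≤m)

  -- Row x has b·m > s·m vertices, so some colour occurs more than m times in it.
  private-colour-exists : ∀ x → ∃[ κ ] Private x κ
  private-colour-exists x
    with k , crowded ← crowded-label m s (toℕ ∘ c) (rowList x)
                         (All.tabulate (λ {w} _ → Fin.toℕ<n (c w)))
                         (ℕ.<-≤-trans (ℕ.*-monoˡ-< m s<b) (ℕ.≤-reflexive (sym (length-rowList x))))
    = crowded⇒private (UniqueP.filter⁺ (has-colour k) (unique-rowList x)) crowded
        (λ w∈ → rowList-position (proj₁ (selected w∈)))
        (λ w∈ w'∈ → Fin.toℕ-injective (trans (proj₂ (selected w∈)) (sym (proj₂ (selected w'∈)))))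
    where
    has-colour : ∀ k w → Dec (toℕ (c w) ≡ k)
    has-colour k w = toℕ (c w) ≟ℕ k
    selected : ∀ {w} → w ∈ filter (has-colour k) (rowList x) → w ∈ rowList x × toℕ (c w) ≡ k
    selected = ∈-filter⁻ (has-colour k) {xs = rowList x}

  private-colour : Fin a → Fin s
  private-colour x = proj₁ (private-colour-exists x)

  privacy : ∀ x w → c w ≡ private-colour x → row w ≡ x
  privacy x = proj₂ (proj₂ (private-colour-exists x))

  private-colour-injective : Injective _≡_ _≡_ private-colour
  private-colour-injective {x} {x'} eq with w , row-w , cw ← proj₁ (proj₂ (private-colour-exists x))
    = trans (sym row-w) (privacy x' w (trans cw eq))

  rows≤colours : a ≤ s
  rows≤colours = Fin.injective⇒≤ private-colour-injective

  row-colouring : (∀ κ → ∃[ x ] private-colour x ≡ κ) → RowColoring c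
  row-colouring every-colour-private u v =
      (λ same-row → trans (colour-of-row u) (trans (cong private-colour same-row) (sym (colour-of-row v))))
    , (λ rows same-colour → rows (privacy (row v) u (trans same-colour (colour-of-row v))))
    where
    colour-of-row : ∀ w → c w ≡ private-colour (row w)
    colour-of-row w with x , eq ← every-colour-private (c w)
      = trans (sym eq) (cong private-colour (sym (privacy x w (sym eq))))

-- The colouring used for a ≤ s < ℓ, on numbers: row x ≠ 0 gets colour x, and in
-- row 0 column y gets the extra colour a + y when y < d, colour 0 otherwise.
split-colour : (a d x y : ℕ) → ℕ
split-colour a d zero y with y <? d
... | yes _ = a + y
... | no _ = 0
split-colour a d (suc x) y = suc x

split-colour-at-d : ∀ a d x → split-colour a d x d ≡ x
split-colour-at-d a d zero with d <? d
... | yes d<d = ⊥-elim (ℕ.n≮n d d<d)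
... | no _ = refl
split-colour-at-d a d (suc x) = refl

split-colour-extra : ∀ a d y → y < d → split-colour a d 0 y ≡ a + y
split-colour-extra a d y y<d with y <? d
... | yes _ = refl
... | no y≮d = ⊥-elim (y≮d y<d)

split-colour-< : ∀ a s x y → a ≤ s → x < a → split-colour a (s ∸ a) x y < s
split-colour-< a s zero y a≤s 0<a with y <? s ∸ a
... | yes y<d = subst (a + y <_) (ℕ.m+[n∸m]≡n a≤s) (ℕ.+-monoʳ-< a y<d)
... | no _ = ℕ.<-≤-trans 0<a a≤s
split-colour-< a s (suc x) y a≤s x<a = ℕ.<-≤-trans x<a a≤s

-- The colour determines the row: the extra colours of row 0 are at least a.
split-colour-rows : ∀ a d {x x' y y'} → x < a → x' < a →
  split-colour a d x y ≡ split-colour a d x' y' → x ≡ x'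
split-colour-rows a d {zero} {zero} _ _ _ = refl
split-colour-rows a d {suc x} {suc x'} _ _ eq = eq
split-colour-rows a d {zero} {suc x'} {y} _ x'<a eq with y <? d
... | yes _ = ⊥-elim (ℕ.≤⇒≯ (ℕ.m≤m+n a y) (subst (_< a) (sym eq) x'<a))
split-colour-rows a d {zero} {suc x'} {y} _ x'<a () | no _
split-colour-rows a d {suc x} {zero} {y} {y'} x<a 0<a eq =
  sym (split-colour-rows a d {y = y'} {y' = y} 0<a x<a (sym eq))

module SplitColouring (a b m s : ℕ) (a≤s : a ≤ s) where

  split : V a b m → Fin s
  split (x , y , _) = fromℕ< (split-colour-< a s (toℕ x) (toℕ y) a≤s (Fin.toℕ<n x))

  toℕ-split : ∀ v → toℕ (split v) ≡ split-colour a (s ∸ a) (toℕ (row v)) (toℕ (col v))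
  toℕ-split (x , y , _) = Fin.toℕ-fromℕ< _

  split-separates-rows : ∀ u v → row u ≢ row v → split u ≢ split v
  split-separates-rows u v rows same-colour = rows (Fin.toℕ-injective
    (split-colour-rows a (s ∸ a) (Fin.toℕ<n (row u)) (Fin.toℕ<n (row v))
      (trans (sym (toℕ-split u)) (trans (cong toℕ same-colour) (toℕ-split v)))))

  hit : 0 < m → ∀ κ {x y} (x<a : x < a) (y<b : y < b) → split-colour a (s ∸ a) x y ≡ toℕ κ →
    ∃[ v ] ∀ {w} → w ≡ v → split w ≡ κ
  hit 0<m κ x<a y<b eq = (fromℕ< x<a , fromℕ< y<b , fromℕ< 0<m) , λ { refl → Fin.toℕ-injective
    (trans (toℕ-split (fromℕ< x<a , fromℕ< y<b , fromℕ< 0<m))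
      (trans (cong₂ (split-colour a (s ∸ a)) (Fin.toℕ-fromℕ< x<a) (Fin.toℕ-fromℕ< y<b)) eq)) }

  -- Colours κ < a appear in column s ∸ a, colours κ ≥ a in row 0, column κ ∸ a.
  split-onto : 0 < a → 0 < m → s < b → IsSColoring s split
  split-onto 0<a 0<m s<b κ with toℕ κ <? a
  ... | yes κ<a =
    hit 0<m κ κ<a (ℕ.≤-<-trans (ℕ.m∸n≤m s a) s<b) (split-colour-at-d a (s ∸ a) (toℕ κ))
  ... | no κ≮a =
    hit 0<m κ 0<a (ℕ.≤-<-trans (ℕ.m∸n≤m (toℕ κ) a) (ℕ.<-trans (Fin.toℕ<n κ) s<b))
      (trans (split-colour-extra a (s ∸ a) (toℕ κ ∸ a) (ℕ.∸-monoˡ-< (Fin.toℕ<n κ) a≤κ))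
             (ℕ.m+[n∸m]≡n a≤κ))
    where
    a≤κ : a ≤ toℕ κ
    a≤κ = ℕ.≮⇒≥ κ≮a

<⇒≤∸1 : ∀ {s ℓ} → s < ℓ → s ≤ ℓ ∸ 1
<⇒≤∸1 (s≤s s≤ℓ-1) = s≤ℓ-1

≤∸1⇒< : ∀ {s ℓ} → 0 < ℓ → s ≤ ℓ ∸ 1 → s < ℓ
≤∸1⇒< {ℓ = suc ℓ} _ s≤ℓ-1 = s≤s s≤ℓ-1

module Claims (ℓ m a b : ℕ) (2≤ℓ : 2 ≤ ℓ) (2≤m : 2 ≤ m) (1<a : 1 < a)
              (a<ℓ : a < ℓ) (ℓ≤b : ℓ ≤ b) where

  0<m : 0 < m
  0<m = ℕ.<-≤-trans (s≤s z≤n) 2≤m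

  0<a : 0 < a
  0<a = ℕ.<-trans (s≤s z≤n) 1<a

  a<b : a < b
  a<b = ℕ.<-≤-trans a<ℓ ℓ≤b

  -- With at least ℓ colours a proper colouring uses exactly b of them;
  -- with fewer (hence fewer than b) it uses at least a.
  spectrum-⊆ : ∀ s → InSpectrum ℓ m a b s → (a ≤ s × s ≤ ℓ ∸ 1) ⊎ s ≡ b
  spectrum-⊆ s (c , onto , proper) with ℓ ≤? s
  ... | yes ℓ≤s = inj₂ (ManyColours.colours≡columns ℓ a b m 2≤ℓ 2≤m 1<a c onto proper ℓ≤s)
  ... | no ℓ≰s =
    inj₁ (FewColours.rows≤colours ℓ a b m 2≤m c proper (ℕ.<-≤-trans s<ℓ ℓ≤b) , <⇒≤∸1 s<ℓ)
    where
    s<ℓ : s < ℓ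
    s<ℓ = ℕ.≰⇒> ℓ≰s

  spectrum-⊇ : ∀ s → (a ≤ s × s ≤ ℓ ∸ 1) ⊎ s ≡ b → InSpectrum ℓ m a b s
  spectrum-⊇ s (inj₁ (a≤s , s≤ℓ-1)) =
      split , split-onto 0<a 0<m (ℕ.<-≤-trans s<ℓ ℓ≤b)
    , row-separating⇒proper 0<m split s<ℓ split-separates-rows
    where
    open SplitColouring a b m s a≤s
    open Edges ℓ a b m
    s<ℓ : s < ℓ
    s<ℓ = ≤∸1⇒< (ℕ.<-trans 0<a a<ℓ) s≤ℓ-1
  spectrum-⊇ s (inj₂ refl) = col , column-onto , Edges.column-colouring-proper ℓ a b m 0<m
    where
    column-onto : IsSColoring b (col {a} {b} {m})
    column-onto y = (fromℕ< 0<a , y , fromℕ< 0<m) , λ { refl → refl }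

  -- With exactly a colours every colour is private to a row.
  row-colourings : ∀ (c : V a b m → Fin a) → IsSColoring a c → Proper ℓ a b m c → RowColoring c
  row-colourings c _ proper = row-colouring (injective⇒onto private-colour private-colour-injective)
    where open FewColours ℓ a b m 2≤m c proper a<b

  column-colourings : ∀ (c : V a b m → Fin b) → IsSColoring b c → Proper ℓ a b m c → ColColoring c
  column-colourings c onto proper = ManyColours.column-colouring ℓ a b m 2≤ℓ 2≤m 1<a c onto proper ℓ≤b

theorem4 : (ℓ m a b : ℕ) → 2 ≤ ℓ → 2 ≤ m → 1 < a → a < ℓ → ℓ ≤ b →
    (∀ s → InSpectrum ℓ m a b s ⇔ ((a ≤ s × s ≤ ℓ ∸ 1) ⊎ s ≡ b))
    × (∀ (c : V a b m → Fin a) → IsSColoring a c → Proper ℓ a b m c → RowColoring c)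
    × (∀ (c : V a b m → Fin b) → IsSColoring b c → Proper ℓ a b m c → ColColoring c)
theorem4 ℓ m a b 2≤ℓ 2≤m 1<a a<ℓ ℓ≤b =
  (λ s → mk⇔ (spectrum-⊆ s) (spectrum-⊇ s)) , row-colourings , column-colourings
  where open Claims ℓ m a b 2≤ℓ 2≤m 1<a a<ℓ ℓ≤b
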